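{- Let $\mathcal{C}$ be a coscorf Cartan scheme, $a$ an object, $\Gamma^a$ its Dynkin diagram, and $i\in I$. (1) For $i_1,\ldots,i_k\in I$, the full subdiagram on $\{i,i_1,\ldots,i_k\}$ is connected in $\Gamma^a$ if and only if it is connected in $\Gamma^{\rho_i(a)}$. Let moreover $j,k\in I$ with $|\{i,j,k\}|=3$. (2) If $i$ is connected neither to $j$ nor to $k$ in $\Gamma^a$, then the connection between $j$ and $k$ (including labels) is the same in $\Gamma^a$ and $\Gamma^{\rho_i(a)}$. (3) If $i$ is connected to $j$ and not connected to $k$ in $\Gamma^a$, then $j$ is connected to $k$ in $\Gamma^a$ if and only if they are connected in $\Gamma^{\rho_i(a)}$.
   Context: Let $I$ be a non-empty finite set and $\{\alpha_i\}_{i\in I}$ the standard basis of $\mathbb{Z}^I$. A generalized Cartan matrix is $C=(c_{ij})\in\mathbb{Z}^{I\times I}$ with $c_{ii}=2$, $c_{jk}\le 0$ for $j\ne k$, and $c_{ij}=0\Rightarrow c_{ji}=0$. A Cartan scheme $\mathcal{C}=(I,A,(\rho_i)_{i\in I},(C^a)_{a\in A})$ consists of a non-empty set $A$ (objects), maps $\rho_i:A\to A$ with $\rho_i^2=\mathrm{id}$, and generalized Cartan matrices $C^a=(c^a_{ij})$ with $c^a_{ij}=c^{\rho_i(a)}_{ij}$. Let $\sigma_i^a(\alpha_j)=\alpha_j-c^a_{ij}\alpha_i$, a morphism $a\to\rho_i(a)$; the Weyl groupoid is the category with objects $A$ whose morphisms are composites of these. Connected: $\mathrm{Hom}(a,b)\ne\emptyset$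 for all $a,b$; simply connected: $\mathrm{Hom}(a,a)=\{\mathrm{id}^a\}$. Real roots $R^a=\{w(\alpha_j)\}$ ($w$ morphisms with target $a$), $R^a_+=R^a\cap\mathbb{N}_0^I$; they form a finite root system if all $R^a$ are finite, $R^a=R^a_+\cup-R^a_+$, $R^a\cap\mathbb{Z}\alpha_i=\{\pm\alpha_i\}$, $\sigma^a_i(R^a)=R^{\rho_i(a)}$, and for $i\neq j$ with $m=|R^a\cap(\mathbb{N}_0\alpha_i+\mathbb{N}_0\alpha_j)|$ one has $(\rho_i\rho_j)^m(a)=a$. A coscorf Cartan scheme is a connected simply connected Cartan scheme whose real roots form a finite root system. The Dynkin diagram $\Gamma^a$ has vertex set $I$; distinct $i,j$ are connected iff $c^a_{ij}\ne0$, with an arrow pointing to $i$ labeled $-c^a_{ij}$. -}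

module Defs where

open import Data.Nat using (ℕ; zero; suc; _<_)
open import Data.Integer as ℤ using (ℤ; 0ℤ; 1ℤ; -1ℤ; _+_; _*_; -_; _-_; _≤_)
open import Data.Fin using (Fin; zero; suc; _≟_)
open import Data.Product using (Σ; ∃; ∃-syntax; _×_; _,_)
open import Data.Sum using (_⊎_)
open import Data.List using (List; []; _∷_; length)
open import Data.List.Relation.Unary.Any using (Any)
open import Data.List.Relation.Unary.AllPairs using (AllPairs)
open import Data.List.Membership.Propositional using (_∈_)
open import Relation.Nullary using (¬_; yes; no)
open import Relation.Binary.PropositionalEquality using (_≡_; _≢_)
open import Function.Bundles using (_⇔_)

Vecℤ : ℕ → Set
Vecℤ n = Fin n → ℤ

_≈_ : {n : ℕ} → Vecℤ n → Vecℤ n → Set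
u ≈ v = ∀ k → u k ≡ v k

α : {n : ℕ} → Fin n → Vecℤ n
α i k with i ≟ k
... | yes _ = 1ℤ
... | no  _ = 0ℤ

neg : {n : ℕ} → Vecℤ n → Vecℤ n
neg v k = - v k

sumFin : (n : ℕ) → (Fin n → ℤ) → ℤ
sumFin zero    f = 0ℤ
sumFin (suc n) f = f zero + sumFin n (λ k → f (suc k))

record IsGCM (n : ℕ) (c : Fin n → Fin n → ℤ) : Set where
  field
    diag    : ∀ i → c i i ≡ ℤ.+ 2
    offdiag : ∀ j k → j ≢ k → c j k ≤ 0ℤ
    zerosym : ∀ i j → c i j ≡ 0ℤ → c j i ≡ 0ℤ

record CartanScheme : Set₁ where
  field
    n        : ℕ
    nonemptyI : 0 < n
    A        : Set
    a₀       : A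
    ρ        : Fin n → A → A
    ρ-invol  : ∀ i a → ρ i (ρ i a) ≡ a
    C        : A → Fin n → Fin n → ℤ
    C-gcm    : ∀ a → IsGCM n (C a)
    C-ρ      : ∀ i j a → C a i j ≡ C (ρ i a) i j

  I : Set
  I = Fin n

  -- σ_i^a as linear map ℤ^I → ℤ^I:  σ_i^a(v) = v - (Σ_j c^a_ij v_j) α_i,
  -- so that σ_i^a(α_j) = α_j - c^a_ij α_i.
  σ : I → A → Vecℤ n → Vecℤ n
  σ i a v k = v k - sumFin n (λ j → C a i j * v j) * α i k

  -- morphisms of the Weyl groupoid as words: Word b a is a composite
  -- σ_{i_r} ⋯ σ_{i_1}^b : b → a
  data Word : A → A → Set where
    nil  : ∀ {b} → Word b b
    cons : ∀ {b a} (i : I) → Word (ρ i b) a → Word b a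

  act : ∀ {b a} → Word b a → Vecℤ n → Vecℤ n
  act nil        v = v
  act (cons {b} i w) v = act w (σ i b v)

  Connected : Set
  Connected = ∀ a b → Word a b

  -- Hom(a,a) = {id}: every endomorphism acts as the identity map
  SimplyConnected : Set
  SimplyConnected = ∀ a (w : Word a a) v → act w v ≈ v

  IsRoot : A → Vecℤ n → Set
  IsRoot a v = Σ A λ b → Σ (Word b a) λ w → Σ I λ j → act w (α j) ≈ v

  Nonneg : Vecℤ n → Set
  Nonneg v = ∀ k → 0ℤ ≤ v k

  InCone : I → I → Vecℤ n → Set
  InCone i j v = Σ ℕ λ p → Σ ℕ λ q →
    v ≈ (λ k → ℤ.+ p * α i k + ℤ.+ q * α j k)

  iterρρ : I → I → ℕ → A → A
  iterρρ i j zero    a = a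
  iterρρ i j (suc m) a = ρ i (ρ j (iterρρ i j m a))

  record FiniteRootSystem : Set where
    field
      finite  : ∀ a → Σ (List (Vecℤ n)) λ L → ∀ v → IsRoot a v → Any (_≈ v) L
      pos-neg : ∀ a v → IsRoot a v ⇔
                 ((IsRoot a v × Nonneg v) ⊎ (IsRoot a (neg v) × Nonneg (neg v)))
      simple  : ∀ a i (v : Vecℤ n) (t : ℤ) → IsRoot a v →
                 v ≈ (λ k → t * α i k) → (t ≡ 1ℤ ⊎ t ≡ -1ℤ)
      σ-root  : ∀ a i → (∀ v → IsRoot a v → IsRoot (ρ i a) (σ i a v))
                 × (∀ w → IsRoot (ρ i a) w → Σ (Vecℤ n) λ v → IsRoot a v × (σ i a v ≈ w))
      -- m = |R^a ∩ (ℕ₀α_i + ℕ₀α_j)|, given by any duplicate-free exact enumeration L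
      coxeter : ∀ a i j → i ≢ j → (L : List (Vecℤ n)) →
                 (∀ v → (IsRoot a v × InCone i j v) ⇔ Any (_≈ v) L) →
                 AllPairs (λ u w → ¬ (u ≈ w)) L →
                 iterρρ i j (length L) a ≡ a

  Adj : A → I → I → Set
  Adj a x y = x ≢ y × C a x y ≢ 0ℤ

  data Reach (a : A) (S : List I) : I → I → Set where
    here : ∀ {x} → Reach a S x x
    step : ∀ {x y z} → z ∈ S → Adj a x z → Reach a S z y → Reach a S x y

  SubConnected : A → List I → Set
  SubConnected a S = ∀ x y → x ∈ S → y ∈ S → Reach a S x y

record Coscorf : Set₁ where
  field
    scheme : CartanScheme
  open CartanScheme scheme
  field
    connected        : Connected
    simplyConnected  : SimplyConnected
    finiteRootSystem : FiniteRootSystem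

-- Only two properties of the real roots are used: every root is either
-- non-negative or non-positive, and σ_i^a maps roots at a to roots at ρ_i(a).
-- From these we derive the two root-string facts
--   * α_k − c^y_jk α_j is a root at y (it is σ_j(α_k), read at ρ_j ρ_j y = y);
--   * if α_k + t α_j is a root at b, then t ≤ −c^b_jk (apply σ_j^b and look
--     at the sign of the α_j-coefficient).
-- If i is orthogonal to j and k at y, the root α_k − c^y_jk α_j is fixed by
-- σ_i, so the string bound at ρ_i(y) gives c^{ρ_i y}_jk ≤ c^y_jk; by symmetry
-- of ρ_i this is an equality (part 2).  If only c^y_ik = 0, applying σ_i and
-- then σ_k to the same root shows that c^{ρ_i y}_jk = 0 forces c^y_jk = 0, so
-- adjacency of j and k is unchanged (part 3).  Finally every edge of Γ^y
-- inside a vertex set containing i becomes an edge or a two-step path through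
-- i in Γ^{ρ_i y}; lifting paths edge by edge gives part 1.
module Submission where

open import Defs
open import Data.Integer using (0ℤ)
open import Data.List using (List; _∷_)
open import Data.Product using (_×_)
open import Relation.Binary.PropositionalEquality using (_≡_; _≢_)
open import Function.Bundles using (_⇔_)

open import Data.Nat using (ℕ; suc; z≤n; s≤s)
open import Data.Integer as ℤ using (ℤ; 1ℤ; -1ℤ; _+_; _*_; -_; _-_; _≤_; _<_)
open import Data.Integer.Properties
  using (+-*-semiring; ≤-antisym; ≤⇒≯; neg-mono-<; neg-cancel-≤; 0≤i-j⇒j≤i; neg-involutive)
open import Data.Integer.Tactic.RingSolver using (solve-∀)
open import Algebra.Properties.Semiring.Sum +-*-semiring
  using (sum; sum-cong-≗; ∑-distrib-+; *-distribˡ-sum; sum-remove; sum-replicate-zero)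
open import Data.Fin using (Fin; zero; suc; _≟_; punchIn)
open import Data.Fin.Properties using (punchInᵢ≢i)
open import Data.Product using (_,_; proj₁; proj₂)
open import Data.Sum using (inj₁; inj₂)
open import Data.List.Relation.Unary.Any using (here)
open import Data.List.Membership.Propositional using (_∈_)
open import Data.Empty using (⊥-elim)
open import Relation.Nullary using (yes; no)
open import Relation.Binary.PropositionalEquality using (refl; sym; trans; cong; cong₂; subst; ≢-sym; module ≡-Reasoning)
open import Function.Bundles using (Equivalence; mk⇔)

α-diag : ∀ {m} (k : Fin m) → α k k ≡ 1ℤ
α-diag k with k ≟ k
... | yes _  = refl
... | no k≢k = ⊥-elim (k≢k refl)

α-off : ∀ {m} {k l : Fin m} → k ≢ l → α k l ≡ 0ℤ
α-off {k = k} {l} k≢l with k ≟ l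
... | yes k≡l = ⊥-elim (k≢l k≡l)
... | no _    = refl

sumFin≡sum : ∀ {p} (f : Fin p → ℤ) → sumFin p f ≡ sum f
sumFin≡sum {ℕ.zero} f = refl
sumFin≡sum {suc p}  f = cong (f zero +_) (sumFin≡sum (λ l → f (suc l)))

sum-select : ∀ {p} (f : Fin p → ℤ) (k : Fin p) → sum (λ l → f l * α k l) ≡ f k
sum-select {suc p} f k = begin
  sum (λ l → f l * α k l)                                       ≡⟨ sum-remove {i = k} (λ l → f l * α k l) ⟩
  f k * α k k + sum (λ l → f (punchIn k l) * α k (punchIn k l))
    ≡⟨ cong₂ _+_ (cong (f k *_) (α-diag k)) (trans (sum-cong-≗ off-k) (sum-replicate-zero p)) ⟩
  f k * 1ℤ + 0ℤ                                                 ≡⟨ unit (f k) ⟩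
  f k                                                           ∎
  where
  open ≡-Reasoning
  off-k : ∀ l → f (punchIn k l) * α k (punchIn k l) ≡ 0ℤ
  off-k l = trans (cong (f (punchIn k l) *_) (α-off (λ k≡ → punchInᵢ≢i k l (sym k≡)))) (times-zero (f (punchIn k l)))
    where
    times-zero : ∀ a → a * 0ℤ ≡ 0ℤ
    times-zero = solve-∀
  unit : ∀ a → a * 1ℤ + 0ℤ ≡ a
  unit = solve-∀

module _ {m : ℕ} where

  infixl 26 _+ᵥ_
  infixl 27 _·ᵥ_

  _+ᵥ_ : Vecℤ m → Vecℤ m → Vecℤ m
  (u +ᵥ v) l = u l + v l

  _·ᵥ_ : ℤ → Vecℤ m → Vecℤ m
  (t ·ᵥ v) l = t * v l

  ⟪_,_⟫ : Vecℤ m → Vecℤ m → ℤ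
  ⟪ f , v ⟫ = sumFin m (λ l → f l * v l)

  ≈-trans : {u v w : Vecℤ m} → u ≈ v → v ≈ w → u ≈ w
  ≈-trans p q l = trans (p l) (q l)

  pairing≡sum : (f v : Vecℤ m) → ⟪ f , v ⟫ ≡ sum (λ l → f l * v l)
  pairing≡sum f v = sumFin≡sum (λ l → f l * v l)

  pairing-cong : (f : Vecℤ m) {u v : Vecℤ m} → u ≈ v → ⟪ f , u ⟫ ≡ ⟪ f , v ⟫
  pairing-cong f {u} {v} u≈v = trans (pairing≡sum f u)
    (trans (sum-cong-≗ (λ l → cong (f l *_) (u≈v l))) (sym (pairing≡sum f v)))

  pairing-+ : (f u v : Vecℤ m) → ⟪ f , u +ᵥ v ⟫ ≡ ⟪ f , u ⟫ + ⟪ f , v ⟫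
  pairing-+ f u v = begin
    ⟪ f , u +ᵥ v ⟫                          ≡⟨ pairing≡sum f (u +ᵥ v) ⟩
    sum (λ l → f l * (u l + v l))           ≡⟨ sum-cong-≗ (λ l → distrib (f l) (u l) (v l)) ⟩
    sum (λ l → f l * u l + f l * v l)       ≡⟨ ∑-distrib-+ (λ l → f l * u l) (λ l → f l * v l) ⟩
    sum (λ l → f l * u l) + sum (λ l → f l * v l)
      ≡⟨ sym (cong₂ _+_ (pairing≡sum f u) (pairing≡sum f v)) ⟩
    ⟪ f , u ⟫ + ⟪ f , v ⟫                   ∎
    where
    open ≡-Reasoning
    distrib : ∀ a b c → a * (b + c) ≡ a * b + a * c
    distrib = solve-∀

  pairing-· : (f : Vecℤ m) (t : ℤ) (v : Vecℤ m) → ⟪ f , t ·ᵥ v ⟫ ≡ t * ⟪ f , v ⟫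
  pairing-· f t v = begin
    ⟪ f , t ·ᵥ v ⟫                 ≡⟨ pairing≡sum f (t ·ᵥ v) ⟩
    sum (λ l → f l * (t * v l))    ≡⟨ sum-cong-≗ (λ l → swap (f l) t (v l)) ⟩
    sum (λ l → t * (f l * v l))    ≡⟨ sym (*-distribˡ-sum t (λ l → f l * v l)) ⟩
    t * sum (λ l → f l * v l)      ≡⟨ cong (t *_) (sym (pairing≡sum f v)) ⟩
    t * ⟪ f , v ⟫                  ∎
    where
    open ≡-Reasoning
    swap : ∀ a b c → a * (b * c) ≡ b * (a * c)
    swap = solve-∀

  pairing-α : (f : Vecℤ m) (k : Fin m) → ⟪ f , α k ⟫ ≡ f k
  pairing-α f k = trans (pairing≡sum f (α k)) (sum-select f k)

  pairing-string : (f : Vecℤ m) (k j : Fin m) (t : ℤ) → ⟪ f , α k +ᵥ t ·ᵥ α j ⟫ ≡ f k + t * f j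
  pairing-string f k j t =
    trans (pairing-+ f (α k) (t ·ᵥ α j))
          (cong₂ _+_ (pairing-α f k)
             (trans (pairing-· f t (α j)) (cong (t *_) (pairing-α f j))))

  string-at-head : {k j : Fin m} (t : ℤ) → k ≢ j → (α k +ᵥ t ·ᵥ α j) k ≡ 1ℤ
  string-at-head {k} {j} t k≢j =
    trans (cong₂ (λ a b → a + t * b) (α-diag k) (α-off (≢-sym k≢j)))
          (one t)
    where
    one : ∀ t → 1ℤ + t * 0ℤ ≡ 1ℤ
    one = solve-∀

  string-at-tail : {k j : Fin m} (t : ℤ) → k ≢ j → (α k +ᵥ t ·ᵥ α j) j ≡ t
  string-at-tail {k} {j} t k≢j =
    trans (cong₂ (λ a b → a + t * b) (α-off k≢j) (α-diag j)) (coeff t)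
    where
    coeff : ∀ t → 0ℤ + t * 1ℤ ≡ t
    coeff = solve-∀

module Paths (𝒮 : CartanScheme) where
  open CartanScheme 𝒮

  -- Dynkin diagrams are undirected, because c_xz = 0 iff c_zx = 0.
  Adj-sym : ∀ {y x z} → Adj y x z → Adj y z x
  Adj-sym {y} {x} {z} (x≢z , c≢0) =
    ≢-sym x≢z , (λ c-zx → c≢0 (IsGCM.zerosym (C-gcm y) z x c-zx))

  reach-++ : ∀ {y S x z w} → Reach y S x z → Reach y S z w → Reach y S x w
  reach-++ here                 q = q
  reach-++ (step z∈S adj p) q = step z∈S adj (reach-++ p q)

  reach-map : ∀ {y y′ S} → (∀ {x z} → z ∈ S → Adj y x z → Reach y′ S x z) →
              ∀ {x w} → Reach y S x w → Reach y′ S x w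
  reach-map edge here               = here
  reach-map edge (step z∈S adj p) = reach-++ (edge z∈S adj) (reach-map edge p)

module RootStrings (𝒮 : CartanScheme) (roots : CartanScheme.FiniteRootSystem 𝒮) where
  open CartanScheme 𝒮
  open FiniteRootSystem roots
  open IsGCM
  open Paths 𝒮

  σ-as-string : ∀ i a v → σ i a v ≈ v +ᵥ (- ⟪ C a i , v ⟫) ·ᵥ α i
  σ-as-string i a v l = minus (v l) ⟪ C a i , v ⟫ (α i l)
    where
    minus : ∀ x p y → x - p * y ≡ x + (- p) * y
    minus = solve-∀

  σ-off : ∀ i a v {l} → i ≢ l → σ i a v l ≡ v l
  σ-off i a v {l} i≢l = trans (cong (λ e → v l - ⟪ C a i , v ⟫ * e) (α-off i≢l)) (drop (v l) ⟪ C a i , v ⟫)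
    where
    drop : ∀ x p → x - p * 0ℤ ≡ x
    drop = solve-∀

  σ-at : ∀ i a v → σ i a v i ≡ v i - ⟪ C a i , v ⟫
  σ-at i a v = trans (cong (λ e → v i - ⟪ C a i , v ⟫ * e) (α-diag i)) (unit (v i) ⟪ C a i , v ⟫)
    where
    unit : ∀ x p → x - p * 1ℤ ≡ x - p
    unit = solve-∀

  σ-fix : ∀ i a v → ⟪ C a i , v ⟫ ≡ 0ℤ → σ i a v ≈ v
  σ-fix i a v orth l = trans (cong (λ p → v l - p * α i l) orth) (drop (v l) (α i l))
    where
    drop : ∀ x y → x - 0ℤ * y ≡ x
    drop = solve-∀

  pairing-σ : ∀ (f : Vecℤ n) i a v → ⟪ f , σ i a v ⟫ ≡ ⟪ f , v ⟫ - ⟪ C a i , v ⟫ * f i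
  pairing-σ f i a v = begin
    ⟪ f , σ i a v ⟫                                   ≡⟨ pairing-cong f (σ-as-string i a v) ⟩
    ⟪ f , v +ᵥ (- p) ·ᵥ α i ⟫                         ≡⟨ pairing-+ f v ((- p) ·ᵥ α i) ⟩
    ⟪ f , v ⟫ + ⟪ f , (- p) ·ᵥ α i ⟫                  ≡⟨ cong (⟪ f , v ⟫ +_) (pairing-· f (- p) (α i)) ⟩
    ⟪ f , v ⟫ + (- p) * ⟪ f , α i ⟫                   ≡⟨ cong (λ e → ⟪ f , v ⟫ + (- p) * e) (pairing-α f i) ⟩
    ⟪ f , v ⟫ + (- p) * f i                           ≡⟨ minus ⟪ f , v ⟫ p (f i) ⟩
    ⟪ f , v ⟫ - p * f i                               ∎
    where
    open ≡-Reasoning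
    p = ⟪ C a i , v ⟫
    minus : ∀ x p y → x + (- p) * y ≡ x - p * y
    minus = solve-∀

  IsRoot-cong : ∀ {a v w} → IsRoot a v → v ≈ w → IsRoot a w
  IsRoot-cong (b , word , j , p) v≈w = b , word , j , ≈-trans p v≈w

  root-α : ∀ a j → IsRoot a (α j)
  root-α a j = a , nil , j , λ _ → refl

  root-σ : ∀ i a {v} → IsRoot a v → IsRoot (ρ i a) (σ i a v)
  root-σ i a {v} = proj₁ (σ-root a i) v

  root-nonneg : ∀ {a v} k → IsRoot a v → 0ℤ < v k → Nonneg v
  root-nonneg {a} {v} k r pos with Equivalence.to (pos-neg a v) r
  ... | inj₁ (_ , nn) = nn
  ... | inj₂ (_ , nn) = ⊥-elim (≤⇒≯ (nn k) (neg-mono-< pos))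

  root-nonpos : ∀ {a v} k → IsRoot a v → v k < 0ℤ → Nonneg (neg v)
  root-nonpos {a} {v} k r neg with Equivalence.to (pos-neg a v) r
  ... | inj₁ (_ , nn) = ⊥-elim (≤⇒≯ (nn k) neg)
  ... | inj₂ (_ , nn) = nn

  -- α_k − c^y_jk α_j is a root at y: it is σ_j(α_k) read at ρ_j(ρ_j y) = y.
  string-root : ∀ y j k → IsRoot y (α k +ᵥ (- C y j k) ·ᵥ α j)
  string-root y j k =
    IsRoot-cong (subst (λ b → IsRoot b (σ j (ρ j y) (α k))) (ρ-invol j y) (root-σ j (ρ j y) (root-α (ρ j y) k)))
                (≈-trans (σ-as-string j (ρ j y) (α k))
                         (λ l → cong (λ p → α k l + (- p) * α j l) pairing≡c))
    where
    pairing≡c : ⟪ C (ρ j y) j , α k ⟫ ≡ C y j k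
    pairing≡c = trans (pairing-α (C (ρ j y) j) k) (sym (C-ρ j k y))

  -- The α_j-string through α_k has length at most −c^b_jk: applying σ_j^b to
  -- the root α_k + t α_j gives α_k + (−c^b_jk − t) α_j, a root whose
  -- α_k-coefficient is 1, hence a positive root.
  string-bound : ∀ b j k t → j ≢ k → IsRoot b (α k +ᵥ t ·ᵥ α j) → t ≤ - C b j k
  string-bound b j k t j≢k r = 0≤i-j⇒j≤i (subst (0ℤ ≤_) image-at-j (image-nonneg j))
    where
    v = α k +ᵥ t ·ᵥ α j
    k≢j = ≢-sym j≢k
    image-nonneg : Nonneg (σ j b v)
    image-nonneg = root-nonneg k (root-σ j b r)
      (subst (0ℤ <_) (sym (trans (σ-off j b v j≢k) (string-at-head t k≢j))) (ℤ.+<+ (s≤s z≤n)))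
    rearrange : ∀ t c → t - (c + t * ℤ.+ 2) ≡ - c - t
    rearrange = solve-∀
    image-at-j : σ j b v j ≡ - C b j k - t
    image-at-j = begin
      σ j b v j                             ≡⟨ σ-at j b v ⟩
      v j - ⟪ C b j , v ⟫                   ≡⟨ cong₂ _-_ (string-at-tail t k≢j) (pairing-string (C b j) k j t) ⟩
      t - (C b j k + t * C b j j)           ≡⟨ cong (λ d → t - (C b j k + t * d)) (diag (C-gcm b) j) ⟩
      t - (C b j k + t * ℤ.+ 2)             ≡⟨ rearrange t (C b j k) ⟩
      - C b j k - t                         ∎
      where open ≡-Reasoning

  -- If i is orthogonal to j and k at y, the root α_k − c^y_jk α_j is fixed by
  -- σ_i, hence is a root at ρ_i(y), and the string bound there gives
  -- c^{ρ_i y}_jk ≤ c^y_jk.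
  label-decreases : ∀ y i j k → j ≢ k → C y i j ≡ 0ℤ → C y i k ≡ 0ℤ → C (ρ i y) j k ≤ C y j k
  label-decreases y i j k j≢k c-ij c-ik =
    neg-cancel-≤ (string-bound (ρ i y) j k (- C y j k) j≢k
      (IsRoot-cong (root-σ i y (string-root y j k)) (σ-fix i y u orthogonal)))
    where
    u = α k +ᵥ (- C y j k) ·ᵥ α j
    vanish : ∀ s → 0ℤ + s * 0ℤ ≡ 0ℤ
    vanish = solve-∀
    orthogonal : ⟪ C y i , u ⟫ ≡ 0ℤ
    orthogonal = trans (pairing-string (C y i) k j (- C y j k))
                       (trans (cong₂ (λ a b → a + (- C y j k) * b) c-ik c-ij) (vanish (- C y j k)))

  -- Part 2: the label c_jk is unchanged (apply label-decreases at y and at ρ_i y).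
  label-invariant : ∀ y i j k → j ≢ k → C y i j ≡ 0ℤ → C y i k ≡ 0ℤ → C y j k ≡ C (ρ i y) j k
  label-invariant y i j k j≢k c-ij c-ik = ≤-antisym
    (subst (λ b → C b j k ≤ C (ρ i y) j k) (ρ-invol i y)
       (label-decreases (ρ i y) i j k j≢k (trans (sym (C-ρ i j y)) c-ij) (trans (sym (C-ρ i k y)) c-ik)))
    (label-decreases y i j k j≢k c-ij c-ik)

  -- If c^y_ik = 0 and c^{ρ_i y}_jk = 0 then c^y_jk = 0: σ_i^y sends the root
  -- u = α_k − c^y_jk α_j to a root w at z = ρ_i(y) with the same j- and
  -- k-coordinates; as c^z_kj = c^z_ki = 0, σ_k^z(w) = w − 2α_k is a negative
  -- root, so its j-coordinate −c^y_jk is ≤ 0.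
  vanishing-reflected : ∀ y i j k → i ≢ j → i ≢ k → j ≢ k →
                        C y i k ≡ 0ℤ → C (ρ i y) j k ≡ 0ℤ → C y j k ≡ 0ℤ
  vanishing-reflected y i j k i≢j i≢k j≢k c-ik c′-jk =
    ≤-antisym (offdiag (C-gcm y) j k j≢k)
              (subst (0ℤ ≤_) (neg-involutive (C y j k)) (subst (λ e → 0ℤ ≤ - e) x-at-j (x-nonpos j)))
    where
    open ≡-Reasoning
    z = ρ i y
    s = - C y j k
    u = α k +ᵥ s ·ᵥ α j
    w = σ i y u
    x = σ k z w
    k≢j = ≢-sym j≢k
    c′-kj : C z k j ≡ 0ℤ
    c′-kj = zerosym (C-gcm z) j k c′-jk
    c′-ki : C z k i ≡ 0ℤ
    c′-ki = zerosym (C-gcm z) i k (trans (sym (C-ρ i k y)) c-ik)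
    two : ∀ s p → ℤ.+ 2 + s * 0ℤ - p * 0ℤ ≡ ℤ.+ 2
    two = solve-∀
    w-pairing : ⟪ C z k , w ⟫ ≡ ℤ.+ 2
    w-pairing = begin
      ⟪ C z k , w ⟫                                           ≡⟨ pairing-σ (C z k) i y u ⟩
      ⟪ C z k , u ⟫ - ⟪ C y i , u ⟫ * C z k i                 ≡⟨ cong₂ (λ a b → a - ⟪ C y i , u ⟫ * b) (pairing-string (C z k) k j s) c′-ki ⟩
      C z k k + s * C z k j - ⟪ C y i , u ⟫ * 0ℤ               ≡⟨ cong₂ (λ a b → a + s * b - ⟪ C y i , u ⟫ * 0ℤ) (diag (C-gcm z) k) c′-kj ⟩
      ℤ.+ 2 + s * 0ℤ - ⟪ C y i , u ⟫ * 0ℤ                      ≡⟨ two s ⟪ C y i , u ⟫ ⟩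
      ℤ.+ 2                                                   ∎
    x-at-k : x k ≡ -1ℤ
    x-at-k = begin
      x k                    ≡⟨ σ-at k z w ⟩
      w k - ⟪ C z k , w ⟫    ≡⟨ cong₂ _-_ (trans (σ-off i y u i≢k) (string-at-head s k≢j)) w-pairing ⟩
      1ℤ - ℤ.+ 2             ≡⟨⟩
      -1ℤ                    ∎
    x-at-j : x j ≡ s
    x-at-j = trans (σ-off k z w k≢j) (trans (σ-off i y u i≢j) (string-at-tail s k≢j))
    x-nonpos : Nonneg (neg x)
    x-nonpos = root-nonpos k (root-σ k z (root-σ i y (string-root y j k))) (subst (_< 0ℤ) (sym x-at-k) ℤ.-<+)

  -- Part 3: if c^y_ik = 0, then j
  -- and k are adjacent at y exactly when they are adjacent at ρ_i(y).
  adjacency-invariant : ∀ y i j k → i ≢ j → i ≢ k → j ≢ k → C y i k ≡ 0ℤ →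
                        C y j k ≢ 0ℤ ⇔ C (ρ i y) j k ≢ 0ℤ
  adjacency-invariant y i j k i≢j i≢k j≢k c-ik = mk⇔
    (λ c-jk≢0 c′-jk → c-jk≢0 (vanishing-reflected y i j k i≢j i≢k j≢k c-ik c′-jk))
    (λ c′-jk≢0 c-jk → c′-jk≢0 (vanishing-reflected (ρ i y) i j k i≢j i≢k j≢k
       (trans (sym (C-ρ i k y)) c-ik) (subst (λ b → C b j k ≡ 0ℤ) (sym (ρ-invol i y)) c-jk)))

  -- Edges at i survive the reflection, since c^{ρ_i y}_ix = c^y_ix.
  adj-at-i : ∀ {y i x} → Adj y i x → Adj (ρ i y) i x
  adj-at-i {y} {i} {x} (i≢x , c≢0) = i≢x , (λ c′ → c≢0 (trans (C-ρ i x y) c′))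

  -- An edge x–z of Γ^y with x ≠ i ≠ z becomes a path inside S in Γ^{ρ_i y},
  -- provided i ∈ S: if c^y_iz = 0 or c^y_ix = 0 the edge survives by part 3,
  -- otherwise x and z are both adjacent to i and the path x–i–z is used.
  edge-lift-away : ∀ y i {S x z} → i ∈ S → z ∈ S → Adj y x z → i ≢ x → i ≢ z →
                   Reach (ρ i y) S x z
  edge-lift-away y i {x = x} {z} i∈S z∈S adj@(x≢z , c-xz≢0) i≢x i≢z
    with C y i z ℤ.≟ 0ℤ | C y i x ℤ.≟ 0ℤ
  ... | yes c-iz | _ =
    step z∈S (x≢z , Equivalence.to (adjacency-invariant y i x z i≢x i≢z x≢z c-iz) c-xz≢0) here
  ... | no _ | yes c-ix =
    step z∈S (Adj-sym (≢-sym x≢z , Equivalence.to (adjacency-invariant y i z x i≢z i≢x (≢-sym x≢z) c-ix)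
                                                   (proj₂ (Adj-sym adj)))) here
  ... | no c-iz≢0 | no c-ix≢0 =
    step i∈S (Adj-sym (adj-at-i (i≢x , c-ix≢0))) (step z∈S (adj-at-i (i≢z , c-iz≢0)) here)

  edge-lift : ∀ y i {S x z} → i ∈ S → z ∈ S → Adj y x z → Reach (ρ i y) S x z
  edge-lift y i {x = x} {z} i∈S z∈S adj with x ≟ i | z ≟ i
  ... | yes refl | _        = step z∈S (adj-at-i adj) here
  ... | no _     | yes refl = step z∈S (Adj-sym (adj-at-i (Adj-sym adj))) here
  ... | no x≢i   | no z≢i   = edge-lift-away y i i∈S z∈S adj (≢-sym x≢i) (≢-sym z≢i)

  connected-after-ρ : ∀ y i S → i ∈ S → SubConnected y S → SubConnected (ρ i y) S
  connected-after-ρ y i S i∈S conn x w x∈S w∈S = reach-map (edge-lift y i i∈S) (conn x w x∈S w∈S)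

  connectedness-invariant : ∀ y i S → i ∈ S → SubConnected y S ⇔ SubConnected (ρ i y) S
  connectedness-invariant y i S i∈S = mk⇔ (connected-after-ρ y i S i∈S)
    (λ conn → subst (λ b → SubConnected b S) (ρ-invol i y) (connected-after-ρ (ρ i y) i S i∈S conn))

lemma3p7 : (𝒞 : Coscorf) → 
    let open Coscorf 𝒞
        open CartanScheme scheme
    in
    (a : A) (i : I) →
    (∀ (is : List I) → SubConnected a (i ∷ is) ⇔ SubConnected (ρ i a) (i ∷ is))
    × (∀ (j k : I) → i ≢ j → i ≢ k → j ≢ k →
        (C a i j ≡ 0ℤ → C a i k ≡ 0ℤ →
           (C a j k ≡ C (ρ i a) j k) × (C a k j ≡ C (ρ i a) k j))
        × (C a i j ≢ 0ℤ → C a i k ≡ 0ℤ →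
           (C a j k ≢ 0ℤ ⇔ C (ρ i a) j k ≢ 0ℤ)))
lemma3p7 𝒞 a i =
  (λ is → connectedness-invariant a i (i ∷ is) (here refl)) ,
  λ j k i≢j i≢k j≢k →
    (λ c-ij c-ik → label-invariant a i j k j≢k c-ij c-ik ,
                   label-invariant a i k j (≢-sym j≢k) c-ik c-ij) ,
    (λ _ c-ik → adjacency-invariant a i j k i≢j i≢k j≢k c-ik)
  where
  open Coscorf 𝒞
  open RootStrings scheme finiteRootSystem
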